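{- Let $\mathcal{E}$ be a category in which the notions below make sense (a positive Heyting category, reasoning in its internal logic). Suppose given a commuting diagram $$\begin{array}{ccccc} F & \xrightarrow{\beta} & D & \xrightarrow{\sigma} & B\\ \downarrow & & \downarrow & & \downarrow\\ E & \xrightarrow{\alpha} & C & \xrightarrow{\rho} & A\end{array}$$ in which both inner squares are covering squares (oriented from left to right, i.e. with $\alpha,\rho$ the bottom maps). If one of the two inner squares is a collection square, then the outer square (with top $\sigma\beta$ and bottom $\rho\alpha$) is a collection square.
   Context: A cover is a regular epimorphism. A commuting square with top $q: D\to B$, left $g: D\to C$, right $f: B\to A$, bottom $p: C\to A$ is a covering square if both $p$ and the canonical map $D\to B\times_A C$ are covers. It is a collection square if, in addition, the following holds in the internal logic: for all $a\in A$ and every cover $e: E\twoheadrightarrow B_a$ (with $B_a$ the fibre of $f$ over $a$) there exist $c\in p^{ -1}(a)$ and a map $h: D_c\to E$ (with $D_c$ the fibre of $g$ over $c$) such that $e\circ h = q\restriction D_c$. -}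

module Defs where

open import Level using (Level; _⊔_) renaming (suc to lsuc)
open import Data.Product using (Σ; ∃; ∃-syntax; _×_; _,_)
open import Data.Sum using (_⊎_)
open import Relation.Binary using (Rel; IsEquivalence)

record Category (o ℓ e : Level) : Set (lsuc (o ⊔ ℓ ⊔ e)) where
  infixr 9 _∘_
  infix  4 _≈_
  field
    Obj  : Set o
    _⇒_  : Obj → Obj → Set ℓ
    _≈_  : ∀ {A B} → Rel (A ⇒ B) e
    id   : ∀ {A} → A ⇒ A
    _∘_  : ∀ {A B C} → B ⇒ C → A ⇒ B → A ⇒ C
    equiv     : ∀ {A B} → IsEquivalence (_≈_ {A} {B})
    ∘-resp-≈  : ∀ {A B C} {f h : B ⇒ C} {g i : A ⇒ B} → f ≈ h → g ≈ i → f ∘ g ≈ h ∘ i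
    assoc     : ∀ {A B C D} {f : A ⇒ B} {g : B ⇒ C} {h : C ⇒ D} → (h ∘ g) ∘ f ≈ h ∘ (g ∘ f)
    identityˡ : ∀ {A B} {f : A ⇒ B} → id ∘ f ≈ f
    identityʳ : ∀ {A B} {f : A ⇒ B} → f ∘ id ≈ f

module _ {o ℓ e : Level} (𝒞 : Category o ℓ e) where
  open Category 𝒞

  Mono : ∀ {X Y} → X ⇒ Y → Set (o ⊔ ℓ ⊔ e)
  Mono {X} m = ∀ {Z} (g h : Z ⇒ X) → m ∘ g ≈ m ∘ h → g ≈ h

  Cover : ∀ {X Y} → X ⇒ Y → Set (o ⊔ ℓ ⊔ e)
  Cover {X} {Y} c =
    Σ Obj λ Z → Σ (Z ⇒ X) λ a → Σ (Z ⇒ X) λ b →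
      (c ∘ a ≈ c ∘ b) ×
      (∀ {W} (g : X ⇒ W) → g ∘ a ≈ g ∘ b →
         Σ (Y ⇒ W) λ k → (k ∘ c ≈ g) × (∀ (k' : Y ⇒ W) → k' ∘ c ≈ g → k' ≈ k))

  IsInitial : Obj → Set (o ⊔ ℓ ⊔ e)
  IsInitial I = ∀ X → Σ (I ⇒ X) λ u → ∀ (v : I ⇒ X) → v ≈ u

  IsTerminal : Obj → Set (o ⊔ ℓ ⊔ e)
  IsTerminal T = ∀ X → Σ (X ⇒ T) λ u → ∀ (v : X ⇒ T) → v ≈ u

  IsPullback : ∀ {A B C P} (f : B ⇒ A) (p : C ⇒ A) (π₁ : P ⇒ B) (π₂ : P ⇒ C) → Set (o ⊔ ℓ ⊔ e)
  IsPullback {A} {B} {C} {P} f p π₁ π₂ =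
    (f ∘ π₁ ≈ p ∘ π₂) ×
    (∀ {X} (u : X ⇒ B) (v : X ⇒ C) → f ∘ u ≈ p ∘ v →
       Σ (X ⇒ P) λ m → (π₁ ∘ m ≈ u) × (π₂ ∘ m ≈ v) ×
         (∀ (m' : X ⇒ P) → π₁ ∘ m' ≈ u → π₂ ∘ m' ≈ v → m' ≈ m))

  _≤_ : ∀ {M N X} → M ⇒ X → N ⇒ X → Set (ℓ ⊔ e)
  _≤_ {M} {N} m n = Σ (M ⇒ N) λ k → n ∘ k ≈ m

  IsLeastSub : ∀ {Z X} → Z ⇒ X → Set (o ⊔ ℓ ⊔ e)
  IsLeastSub {X = X} z = Mono z × (∀ {W} (m : W ⇒ X) → Mono m → z ≤ m)

  IsUnion : ∀ {M N U X} → M ⇒ X → N ⇒ X → U ⇒ X → Set (o ⊔ ℓ ⊔ e)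
  IsUnion {X = X} m n u =
    Mono u × (m ≤ u) × (n ≤ u) × (∀ {K} (k : K ⇒ X) → Mono k → m ≤ k → n ≤ k → u ≤ k)

  record IsRegular : Set (o ⊔ ℓ ⊔ e) where
    field
      terminal  : Σ Obj IsTerminal
      pullback  : ∀ {A B C} (f : B ⇒ A) (p : C ⇒ A) →
                    Σ Obj λ P → Σ (P ⇒ B) λ π₁ → Σ (P ⇒ C) λ π₂ → IsPullback f p π₁ π₂
      factor    : ∀ {X Y} (f : X ⇒ Y) →
                    Σ Obj λ I → Σ (X ⇒ I) λ c → Σ (I ⇒ Y) λ m → Cover c × Mono m × (m ∘ c ≈ f)
      cover-stable : ∀ {X Y Z P} (c : X ⇒ Y) (f : Z ⇒ Y) (π₁ : P ⇒ X) (π₂ : P ⇒ Z) →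
                    IsPullback c f π₁ π₂ → Cover c → Cover π₂

  -- Heyting category: regular + finite unions of subobjects stable under pullback
  -- (coherent) + right adjoints ∀_f to pullback of subobjects.
  record IsHeyting : Set (o ⊔ ℓ ⊔ e) where
    field
      regular : IsRegular
      least   : ∀ X → Σ Obj λ Z → Σ (Z ⇒ X) IsLeastSub
      least-stable : ∀ {Z X Y P} (z : Z ⇒ X) (f : Y ⇒ X) (π₁ : P ⇒ Z) (π₂ : P ⇒ Y) →
                    IsPullback z f π₁ π₂ → IsLeastSub z → IsLeastSub π₂
      union   : ∀ {M N X} (m : M ⇒ X) (n : N ⇒ X) → Mono m → Mono n →
                    Σ Obj λ U → Σ (U ⇒ X) λ u → IsUnion m n u
      union-stable : ∀ {M N U X Y M' N' U'} (m : M ⇒ X) (n : N ⇒ X) (u : U ⇒ X) (f : Y ⇒ X)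
                    (μ₁ : M' ⇒ M) (μ₂ : M' ⇒ Y) (ν₁ : N' ⇒ N) (ν₂ : N' ⇒ Y)
                    (υ₁ : U' ⇒ U) (υ₂ : U' ⇒ Y) →
                    IsPullback m f μ₁ μ₂ → IsPullback n f ν₁ ν₂ → IsPullback u f υ₁ υ₂ →
                    Mono m → Mono n → IsUnion m n u → IsUnion μ₂ ν₂ υ₂
      dual-image : ∀ {X Y M} (f : Y ⇒ X) (m : M ⇒ Y) → Mono m →
                    Σ Obj λ F → Σ (F ⇒ X) λ a → Mono a ×
                    (∀ {N P} (n : N ⇒ X) (π₁ : P ⇒ N) (π₂ : P ⇒ Y) → Mono n →
                       IsPullback n f π₁ π₂ → ((π₂ ≤ m → n ≤ a) × (n ≤ a → π₂ ≤ m)))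

  record IsPositiveHeyting : Set (o ⊔ ℓ ⊔ e) where
    field
      heyting   : IsHeyting
      initial   : Σ Obj IsInitial
      coproduct : ∀ X Y → Σ Obj λ S → Σ (X ⇒ S) λ i → Σ (Y ⇒ S) λ j →
                    (∀ {W} (g : X ⇒ W) (h : Y ⇒ W) →
                       Σ (S ⇒ W) λ k → (k ∘ i ≈ g) × (k ∘ j ≈ h) ×
                         (∀ (k' : S ⇒ W) → k' ∘ i ≈ g → k' ∘ j ≈ h → k' ≈ k)) ×
                    Mono i × Mono j ×
                    (∀ {P} (π₁ : P ⇒ X) (π₂ : P ⇒ Y) → IsPullback i j π₁ π₂ → IsInitial P)

  CoveringSquare : ∀ {A B C D} (q : D ⇒ B) (g : D ⇒ C) (f : B ⇒ A) (p : C ⇒ A) → Set (o ⊔ ℓ ⊔ e)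
  CoveringSquare {A} {B} {C} {D} q g f p =
    (f ∘ q ≈ p ∘ g) × Cover p ×
    (∀ {P} (π₁ : P ⇒ B) (π₂ : P ⇒ C) → IsPullback f p π₁ π₂ →
       ∀ (m : D ⇒ P) → π₁ ∘ m ≈ q → π₂ ∘ m ≈ g → Cover m)

  -- Collection square, internal-logic clause read via Kripke–Joyal semantics:
  -- for every stage t : T → A (generalised element a) and every cover e : E ↠ T ×_A B
  -- (cover of the fibre B_a), there are a cover r : T' ↠ T, an element c : T' → C with
  -- p c = t r (c ∈ p⁻¹(a)), and a map h : T' ×_C D → E (h : D_c → E) with e h = q↾D_c,
  -- i.e. e h equals the map T' ×_C D → T ×_A B induced by (r ρ₁ , q ρ₂).
  CollectionSquare : ∀ {A B C D} (q : D ⇒ B) (g : D ⇒ C) (f : B ⇒ A) (p : C ⇒ A) → Set (o ⊔ ℓ ⊔ e)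
  CollectionSquare {A} {B} {C} {D} q g f p =
    CoveringSquare q g f p ×
    (∀ {T P} (t : T ⇒ A) (π₁ : P ⇒ T) (π₂ : P ⇒ B) → IsPullback t f π₁ π₂ →
     ∀ {E} (ε : E ⇒ P) → Cover ε →
       Σ Obj λ T' → Σ (T' ⇒ T) λ r → Σ (T' ⇒ C) λ c →
         Cover r × (p ∘ c ≈ t ∘ r) ×
         (∀ {Q} (ρ₁ : Q ⇒ T') (ρ₂ : Q ⇒ D) → IsPullback c g ρ₁ ρ₂ →
            Σ (Q ⇒ E) λ h → (π₁ ∘ (ε ∘ h) ≈ r ∘ ρ₁) × (π₂ ∘ (ε ∘ h) ≈ q ∘ ρ₂)))

module Submission where

-- The comparison map F → B ×_A E of the outer square factors as the comparison map F → D ×_C E of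
-- the left square followed by a base change of the comparison map D → B ×_A C of the right one,
-- so it is a composite of covers.
-- If the right square is a collection square, it provides c ∈ C over a refinement of the stage and
-- a lift on D_c; pulling the cover α back along c refines the stage further to an e ∈ E, and the
-- lift restricts to F_e, which maps to D_c.
-- If the left square is a collection square, refine the stage t along the cover C ×_A T ↠ T, pull
-- the cover ε of B_t back along σ to the fibres of g over this new stage, and apply it there.

open import Defs
open import Level using (Level; _⊔_)
open import Data.Sum using (_⊎_; inj₁; inj₂)
open import Data.Product using (Σ; _×_; _,_; proj₁; proj₂)
open import Relation.Binary using (Setoid; IsEquivalence)
import Relation.Binary.Reasoning.Setoid as SetoidReasoning

module RegularCategory {o ℓ e : Level} (𝒞 : Category o ℓ e) (regular : IsRegular 𝒞) where
  open Category 𝒞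
  open IsRegular regular using (pullback; factor; cover-stable)

  private
    module ≈ {X Y : Obj} = IsEquivalence (equiv {X} {Y})

  hom-setoid : Obj → Obj → Setoid ℓ e
  hom-setoid X Y = record { Carrier = X ⇒ Y ; _≈_ = _≈_ ; isEquivalence = equiv }

  open module HomReasoning {X Y : Obj} = SetoidReasoning (hom-setoid X Y)
    using (begin_; step-≈-⟩; step-≈-⟨; _∎)

  ∘-resp-≈ˡ : ∀ {X Y Z} {f h : Y ⇒ Z} {g : X ⇒ Y} → f ≈ h → f ∘ g ≈ h ∘ g
  ∘-resp-≈ˡ f≈h = ∘-resp-≈ f≈h ≈.refl

  ∘-resp-≈ʳ : ∀ {X Y Z} {f : Y ⇒ Z} {g i : X ⇒ Y} → g ≈ i → f ∘ g ≈ f ∘ i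
  ∘-resp-≈ʳ g≈i = ∘-resp-≈ ≈.refl g≈i

  sym-assoc : ∀ {W X Y Z} {f : W ⇒ X} {g : X ⇒ Y} {h : Y ⇒ Z} → h ∘ (g ∘ f) ≈ (h ∘ g) ∘ f
  sym-assoc = ≈.sym assoc

  pullˡ : ∀ {W X Y Z} {a : Y ⇒ Z} {b : X ⇒ Y} {c : X ⇒ Z} {f : W ⇒ X} →
          a ∘ b ≈ c → a ∘ (b ∘ f) ≈ c ∘ f
  pullˡ ab≈c = ≈.trans sym-assoc (∘-resp-≈ˡ ab≈c)

  pullʳ : ∀ {W X Y Z} {a : X ⇒ Y} {b : W ⇒ X} {c : W ⇒ Y} {f : Y ⇒ Z} →
          a ∘ b ≈ c → (f ∘ a) ∘ b ≈ f ∘ c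
  pullʳ ab≈c = ≈.trans assoc (∘-resp-≈ʳ ab≈c)

  glue-squares : ∀ {A B C D E F} {q : D ⇒ B} {g : D ⇒ C} {f : B ⇒ A} {p : C ⇒ A}
                 {q' : F ⇒ D} {k : F ⇒ E} {p' : E ⇒ C} →
                 f ∘ q ≈ p ∘ g → g ∘ q' ≈ p' ∘ k → f ∘ (q ∘ q') ≈ (p ∘ p') ∘ k
  glue-squares {q = q} {g} {f} {p} {q'} {k} {p'} right left = begin
    f ∘ (q ∘ q')   ≈⟨ pullˡ right ⟩
    (p ∘ g) ∘ q'   ≈⟨ pullʳ left ⟩
    p ∘ (p' ∘ k)   ≈⟨ sym-assoc ⟩
    (p ∘ p') ∘ k   ∎

  module Pullback {A B C P} {f : B ⇒ A} {p : C ⇒ A} {π₁ : P ⇒ B} {π₂ : P ⇒ C}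
                  (pb : IsPullback 𝒞 f p π₁ π₂) where
    commute : f ∘ π₁ ≈ p ∘ π₂
    commute = proj₁ pb

    module _ {X} {u : X ⇒ B} {v : X ⇒ C} (eq : f ∘ u ≈ p ∘ v) where
      universal : X ⇒ P
      universal = proj₁ (proj₂ pb u v eq)

      π₁∘universal≈u : π₁ ∘ universal ≈ u
      π₁∘universal≈u = proj₁ (proj₂ (proj₂ pb u v eq))

      π₂∘universal≈v : π₂ ∘ universal ≈ v
      π₂∘universal≈v = proj₁ (proj₂ (proj₂ (proj₂ pb u v eq)))

      unique : ∀ (m : X ⇒ P) → π₁ ∘ m ≈ u → π₂ ∘ m ≈ v → m ≈ universal
      unique = proj₂ (proj₂ (proj₂ (proj₂ pb u v eq)))

    jointly-monic : ∀ {X} {x y : X ⇒ P} → π₁ ∘ x ≈ π₁ ∘ y → π₂ ∘ x ≈ π₂ ∘ y → x ≈ y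
    jointly-monic {x = x} {y} π₁x≈π₁y π₂x≈π₂y =
      ≈.trans (unique y-commutes x π₁x≈π₁y π₂x≈π₂y) (≈.sym (unique y-commutes y ≈.refl ≈.refl))
      where
      y-commutes : f ∘ (π₁ ∘ y) ≈ p ∘ (π₂ ∘ y)
      y-commutes = ≈.trans sym-assoc (≈.trans (∘-resp-≈ˡ commute) assoc)

  module PullbackOf {A B C} (f : B ⇒ A) (p : C ⇒ A) where
    P : Obj
    P = proj₁ (pullback f p)

    π₁ : P ⇒ B
    π₁ = proj₁ (proj₂ (pullback f p))

    π₂ : P ⇒ C
    π₂ = proj₁ (proj₂ (proj₂ (pullback f p)))

    isPullback : IsPullback 𝒞 f p π₁ π₂
    isPullback = proj₂ (proj₂ (proj₂ (pullback f p)))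

    open Pullback isPullback public

  IsPullback-swap : ∀ {A B C P} {f : B ⇒ A} {p : C ⇒ A} {π₁ : P ⇒ B} {π₂ : P ⇒ C} →
                    IsPullback 𝒞 f p π₁ π₂ → IsPullback 𝒞 p f π₂ π₁
  IsPullback-swap pb =
    ≈.sym commute ,
    λ u v eq → universal (≈.sym eq) , π₂∘universal≈v (≈.sym eq) , π₁∘universal≈u (≈.sym eq) ,
               λ m π₂m≈u π₁m≈v → unique (≈.sym eq) m π₁m≈v π₂m≈u
    where open Pullback pb

  IsPullback-unglue : ∀ {A B C C' P P'} {f : B ⇒ A} {p : C ⇒ A} {p' : C' ⇒ C} {p'' : C' ⇒ A}
                      {π₁ : P ⇒ B} {π₂ : P ⇒ C} {π₁' : P' ⇒ B} {π₂' : P' ⇒ C'} {w : P' ⇒ P} →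
                      IsPullback 𝒞 f p π₁ π₂ → IsPullback 𝒞 f p'' π₁' π₂' → p ∘ p' ≈ p'' →
                      π₁ ∘ w ≈ π₁' → π₂ ∘ w ≈ p' ∘ π₂' → IsPullback 𝒞 π₂ p' w π₂'
  IsPullback-unglue {C' = C'} {P} {P'} {f} {p} {p'} {p''} {π₁} {π₂} {π₁'} {π₂'} {w}
                    inner outer pp'≈p'' π₁w≈π₁' π₂w≈p'π₂' =
    π₂w≈p'π₂' ,
    λ u v eq → O.universal (outer-eq eq) , w∘universal≈u eq , O.π₂∘universal≈v (outer-eq eq) ,
               λ m wm≈u π₂'m≈v → O.unique (outer-eq eq) m (π₁'∘m≈π₁∘u wm≈u) π₂'m≈v
    where
    module I = Pullback inner
    module O = Pullback outer

    π₁'∘m≈π₁∘u : ∀ {X} {m : X ⇒ P'} {u : X ⇒ P} → w ∘ m ≈ u → π₁' ∘ m ≈ π₁ ∘ u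
    π₁'∘m≈π₁∘u {m = m} {u} wm≈u = begin
      π₁' ∘ m        ≈⟨ ∘-resp-≈ˡ π₁w≈π₁' ⟨
      (π₁ ∘ w) ∘ m   ≈⟨ pullʳ wm≈u ⟩
      π₁ ∘ u         ∎

    module _ {X} {u : X ⇒ P} {v : X ⇒ C'} (eq : π₂ ∘ u ≈ p' ∘ v) where
      outer-eq : f ∘ (π₁ ∘ u) ≈ p'' ∘ v
      outer-eq = begin
        f ∘ (π₁ ∘ u)   ≈⟨ pullˡ I.commute ⟩
        (p ∘ π₂) ∘ u   ≈⟨ pullʳ eq ⟩
        p ∘ (p' ∘ v)   ≈⟨ pullˡ pp'≈p'' ⟩
        p'' ∘ v        ∎

      w∘universal≈u : w ∘ O.universal outer-eq ≈ u
      w∘universal≈u = I.jointly-monic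
        (begin
          π₁ ∘ (w ∘ O.universal outer-eq)   ≈⟨ pullˡ π₁w≈π₁' ⟩
          π₁' ∘ O.universal outer-eq        ≈⟨ O.π₁∘universal≈u outer-eq ⟩
          π₁ ∘ u                            ∎)
        (begin
          π₂ ∘ (w ∘ O.universal outer-eq)   ≈⟨ pullˡ π₂w≈p'π₂' ⟩
          (p' ∘ π₂') ∘ O.universal outer-eq ≈⟨ pullʳ (O.π₂∘universal≈v outer-eq) ⟩
          p' ∘ v                            ≈⟨ eq ⟨
          π₂ ∘ u                            ∎)

  IsCoequalizer : ∀ {Z X Y} (c : X ⇒ Y) (a b : Z ⇒ X) → Set (o ⊔ ℓ ⊔ e)
  IsCoequalizer {X = X} {Y} c a b =
    (c ∘ a ≈ c ∘ b) ×
    (∀ {W} (h : X ⇒ W) → h ∘ a ≈ h ∘ b →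
       Σ (Y ⇒ W) λ k → (k ∘ c ≈ h) × (∀ (k' : Y ⇒ W) → k' ∘ c ≈ h → k' ≈ k))

  IsCoequalizer-resp-≈ : ∀ {Z X Y} {c c' : X ⇒ Y} {a b : Z ⇒ X} →
                         c ≈ c' → IsCoequalizer c a b → IsCoequalizer c' a b
  IsCoequalizer-resp-≈ c≈c' (ca≈cb , universal) =
    ≈.trans (∘-resp-≈ˡ (≈.sym c≈c')) (≈.trans ca≈cb (∘-resp-≈ˡ c≈c')) ,
    λ h ha≈hb → let k , kc≈h , unique = universal h ha≈hb in
      k , ≈.trans (∘-resp-≈ʳ (≈.sym c≈c')) kc≈h ,
      λ k' k'c'≈h → unique k' (≈.trans (∘-resp-≈ʳ c≈c') k'c'≈h)

  iso∘IsCoequalizer : ∀ {Z X I Y} {c : X ⇒ I} {a b : Z ⇒ X} {m : I ⇒ Y} {m⁻¹ : Y ⇒ I} →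
                      m ∘ m⁻¹ ≈ id → m⁻¹ ∘ m ≈ id → IsCoequalizer c a b → IsCoequalizer (m ∘ c) a b
  iso∘IsCoequalizer {c = c} {a} {b} {m} {m⁻¹} mm⁻¹≈id m⁻¹m≈id (ca≈cb , universal) =
    ≈.trans assoc (≈.trans (∘-resp-≈ʳ ca≈cb) sym-assoc) ,
    λ h ha≈hb → let k , kc≈h , unique = universal h ha≈hb in
      k ∘ m⁻¹ ,
      (begin
        (k ∘ m⁻¹) ∘ (m ∘ c)  ≈⟨ pullʳ (pullˡ m⁻¹m≈id) ⟩
        k ∘ (id ∘ c)         ≈⟨ ∘-resp-≈ʳ identityˡ ⟩
        k ∘ c                ≈⟨ kc≈h ⟩
        h                    ∎) ,
      λ k' k'mc≈h → begin
        k'                   ≈⟨ identityʳ ⟨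
        k' ∘ id              ≈⟨ ∘-resp-≈ʳ mm⁻¹≈id ⟨
        k' ∘ (m ∘ m⁻¹)       ≈⟨ sym-assoc ⟩
        (k' ∘ m) ∘ m⁻¹       ≈⟨ ∘-resp-≈ˡ (unique (k' ∘ m) (≈.trans assoc k'mc≈h)) ⟩
        k ∘ m⁻¹              ∎

  Cover-resp-≈ : ∀ {X Y} {c c' : X ⇒ Y} → c ≈ c' → Cover 𝒞 c → Cover 𝒞 c'
  Cover-resp-≈ c≈c' (Z , a , b , coequalizer) = Z , a , b , IsCoequalizer-resp-≈ c≈c' coequalizer

  iso∘Cover : ∀ {X I Y} {c : X ⇒ I} {m : I ⇒ Y} {m⁻¹ : Y ⇒ I} →
              m ∘ m⁻¹ ≈ id → m⁻¹ ∘ m ≈ id → Cover 𝒞 c → Cover 𝒞 (m ∘ c)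
  iso∘Cover mm⁻¹≈id m⁻¹m≈id (Z , a , b , coequalizer) =
    Z , a , b , iso∘IsCoequalizer mm⁻¹≈id m⁻¹m≈id coequalizer

  Cover-lift : ∀ {X Y I Z} {c : X ⇒ Y} {m : I ⇒ Z} → Cover 𝒞 c → Mono 𝒞 m →
               (u : X ⇒ I) (v : Y ⇒ Z) → m ∘ u ≈ v ∘ c →
               Σ (Y ⇒ I) λ d → (d ∘ c ≈ u) × (m ∘ d ≈ v)
  Cover-lift {c = c} {m} (W , a , b , ca≈cb , universal) mono u v mu≈vc =
    let d , dc≈u , _ = universal u u-coequalizes
        _ , _ , vc-unique = universal (v ∘ c) vc-coequalizes
    in d , dc≈u , ≈.trans (vc-unique (m ∘ d) (≈.trans (pullʳ dc≈u) mu≈vc)) (≈.sym (vc-unique v ≈.refl))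
    where
    vc-coequalizes : (v ∘ c) ∘ a ≈ (v ∘ c) ∘ b
    vc-coequalizes = ≈.trans (pullʳ ca≈cb) sym-assoc

    u-coequalizes : u ∘ a ≈ u ∘ b
    u-coequalizes = mono (u ∘ a) (u ∘ b) (begin
      m ∘ (u ∘ a)   ≈⟨ pullˡ mu≈vc ⟩
      (v ∘ c) ∘ a   ≈⟨ vc-coequalizes ⟩
      (v ∘ c) ∘ b   ≈⟨ pullˡ mu≈vc ⟨
      m ∘ (u ∘ b)   ∎)

  -- Factor c₂ ∘ c₁ as m ∘ c; lifting against m first along c₁, then along c₂,
  -- shows that the mono m is split epi, hence an isomorphism.
  Cover-∘ : ∀ {X Y Z} {c₁ : X ⇒ Y} {c₂ : Y ⇒ Z} → Cover 𝒞 c₁ → Cover 𝒞 c₂ → Cover 𝒞 (c₂ ∘ c₁)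
  Cover-∘ {c₁ = c₁} {c₂} c₁-cover c₂-cover =
    let I , c , m , c-cover , m-mono , mc≈c₂c₁ = factor (c₂ ∘ c₁)
        d , _ , md≈c₂ = Cover-lift c₁-cover m-mono c c₂ mc≈c₂c₁
        m⁻¹ , _ , mm⁻¹≈id = Cover-lift c₂-cover m-mono d id (≈.trans md≈c₂ (≈.sym identityˡ))
        m⁻¹m≈id : m⁻¹ ∘ m ≈ id
        m⁻¹m≈id = m-mono (m⁻¹ ∘ m) id (≈.trans (pullˡ mm⁻¹≈id) (≈.trans identityˡ (≈.sym identityʳ)))
    in Cover-resp-≈ mc≈c₂c₁ (iso∘Cover mm⁻¹≈id m⁻¹m≈id c-cover)

  -- B ×_A E ≅ (B ×_A C) ×_C E and D ×_C E ≅ D ×_(B ×_A C) (B ×_A E), so n is a base change of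
  -- the comparison map D → B ×_A C of the covering square.
  comparison-cover-paste-pullback :
    ∀ {A B C D E P Q} {σ : D ⇒ B} {g : D ⇒ C} {f : B ⇒ A} {ρ : C ⇒ A} {α : E ⇒ C}
      {π₁ : P ⇒ B} {π₂ : P ⇒ E} {q₁ : Q ⇒ D} {q₂ : Q ⇒ E} →
    CoveringSquare 𝒞 σ g f ρ → IsPullback 𝒞 f (ρ ∘ α) π₁ π₂ → IsPullback 𝒞 g α q₁ q₂ →
    ∀ (n : Q ⇒ P) → π₁ ∘ n ≈ σ ∘ q₁ → π₂ ∘ n ≈ q₂ → Cover 𝒞 n
  comparison-cover-paste-pullback {D = D} {P = P} {σ = σ} {g} {f} {ρ} {α} {π₁} {π₂} {q₁} {q₂}
    (right-commutes , _ , comparison-cover) outer inner n π₁n≈σq₁ π₂n≈q₂ =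
    cover-stable comparison w q₁ n (IsPullback-swap n-pullback) comparison-is-cover
    where
    module O = Pullback outer
    module I = Pullback inner
    module R = PullbackOf f ρ

    comparison : D ⇒ R.P
    comparison = R.universal right-commutes

    comparison-is-cover : Cover 𝒞 comparison
    comparison-is-cover = comparison-cover R.π₁ R.π₂ R.isPullback comparison
      (R.π₁∘universal≈u right-commutes) (R.π₂∘universal≈v right-commutes)

    w-commutes : f ∘ π₁ ≈ ρ ∘ (α ∘ π₂)
    w-commutes = ≈.trans O.commute assoc

    w : P ⇒ R.P
    w = R.universal w-commutes

    w∘n≈comparison∘q₁ : w ∘ n ≈ comparison ∘ q₁
    w∘n≈comparison∘q₁ = R.jointly-monic
      (begin
        R.π₁ ∘ (w ∘ n)            ≈⟨ pullˡ (R.π₁∘universal≈u w-commutes) ⟩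
        π₁ ∘ n                    ≈⟨ π₁n≈σq₁ ⟩
        σ ∘ q₁                    ≈⟨ pullˡ (R.π₁∘universal≈u right-commutes) ⟨
        R.π₁ ∘ (comparison ∘ q₁)  ∎)
      (begin
        R.π₂ ∘ (w ∘ n)            ≈⟨ pullˡ (R.π₂∘universal≈v w-commutes) ⟩
        (α ∘ π₂) ∘ n              ≈⟨ pullʳ π₂n≈q₂ ⟩
        α ∘ q₂                    ≈⟨ I.commute ⟨
        g ∘ q₁                    ≈⟨ pullˡ (R.π₂∘universal≈v right-commutes) ⟨
        R.π₂ ∘ (comparison ∘ q₁)  ∎)

    w-pullback : IsPullback 𝒞 R.π₂ α w π₂
    w-pullback = IsPullback-unglue R.isPullback outer ≈.refl
      (R.π₁∘universal≈u w-commutes) (R.π₂∘universal≈v w-commutes)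

    n-pullback : IsPullback 𝒞 w comparison n q₁
    n-pullback = IsPullback-unglue (IsPullback-swap w-pullback) (IsPullback-swap inner)
      (R.π₂∘universal≈v right-commutes) π₂n≈q₂ w∘n≈comparison∘q₁

  CollectionWitness : ∀ {A B C D T P E} (q : D ⇒ B) (g : D ⇒ C) (p : C ⇒ A)
                      (t : T ⇒ A) (π₁ : P ⇒ T) (π₂ : P ⇒ B) (ε : E ⇒ P) → Set (o ⊔ ℓ ⊔ e)
  CollectionWitness {C = C} {D} {T} {E = E} q g p t π₁ π₂ ε =
    Σ Obj λ T' → Σ (T' ⇒ T) λ r → Σ (T' ⇒ C) λ c →
      Cover 𝒞 r × (p ∘ c ≈ t ∘ r) ×
      (∀ {Q} (ρ₁ : Q ⇒ T') (ρ₂ : Q ⇒ D) → IsPullback 𝒞 c g ρ₁ ρ₂ →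
         Σ (Q ⇒ E) λ h → (π₁ ∘ (ε ∘ h) ≈ r ∘ ρ₁) × (π₂ ∘ (ε ∘ h) ≈ q ∘ ρ₂))

  CollectionCondition : ∀ {A B C D} (q : D ⇒ B) (g : D ⇒ C) (f : B ⇒ A) (p : C ⇒ A) →
                        Set (o ⊔ ℓ ⊔ e)
  CollectionCondition {A} {B} q g f p =
    ∀ {T P} (t : T ⇒ A) (π₁ : P ⇒ T) (π₂ : P ⇒ B) → IsPullback 𝒞 t f π₁ π₂ →
    ∀ {E} (ε : E ⇒ P) → Cover 𝒞 ε → CollectionWitness q g p t π₁ π₂ ε

  module _ {A B C D E F} {β : F ⇒ D} {σ : D ⇒ B} {k : F ⇒ E} {g : D ⇒ C}
           {f : B ⇒ A} {α : E ⇒ C} {ρ : C ⇒ A} where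

    CoveringSquare-paste : CoveringSquare 𝒞 β k g α → CoveringSquare 𝒞 σ g f ρ →
                           CoveringSquare 𝒞 (σ ∘ β) k f (ρ ∘ α)
    CoveringSquare-paste (left-commutes , α-cover , left-comparison-cover)
                         right@(right-commutes , ρ-cover , _) =
      glue-squares right-commutes left-commutes , Cover-∘ α-cover ρ-cover ,
      outer-comparison-cover
      where
      module L = PullbackOf g α

      comparisonˡ : F ⇒ L.P
      comparisonˡ = L.universal left-commutes

      comparisonˡ-cover : Cover 𝒞 comparisonˡ
      comparisonˡ-cover = left-comparison-cover L.π₁ L.π₂ L.isPullback comparisonˡ
        (L.π₁∘universal≈u left-commutes) (L.π₂∘universal≈v left-commutes)

      outer-comparison-cover : ∀ {P} (π₁ : P ⇒ B) (π₂ : P ⇒ E) → IsPullback 𝒞 f (ρ ∘ α) π₁ π₂ →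
                               ∀ (m : F ⇒ P) → π₁ ∘ m ≈ σ ∘ β → π₂ ∘ m ≈ k → Cover 𝒞 m
      outer-comparison-cover {P} π₁ π₂ outer m π₁m≈σβ π₂m≈k =
        Cover-resp-≈ n∘comparisonˡ≈m (Cover-∘ comparisonˡ-cover
          (comparison-cover-paste-pullback right outer L.isPullback n
             (O.π₁∘universal≈u n-commutes) (O.π₂∘universal≈v n-commutes)))
        where
        module O = Pullback outer

        n-commutes : f ∘ (σ ∘ L.π₁) ≈ (ρ ∘ α) ∘ L.π₂
        n-commutes = glue-squares right-commutes L.commute

        n : L.P ⇒ P
        n = O.universal n-commutes

        n∘comparisonˡ≈m : n ∘ comparisonˡ ≈ m
        n∘comparisonˡ≈m = O.jointly-monic
          (begin
            π₁ ∘ (n ∘ comparisonˡ)     ≈⟨ pullˡ (O.π₁∘universal≈u n-commutes) ⟩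
            (σ ∘ L.π₁) ∘ comparisonˡ   ≈⟨ pullʳ (L.π₁∘universal≈u left-commutes) ⟩
            σ ∘ β                      ≈⟨ π₁m≈σβ ⟨
            π₁ ∘ m                     ∎)
          (begin
            π₂ ∘ (n ∘ comparisonˡ)     ≈⟨ pullˡ (O.π₂∘universal≈v n-commutes) ⟩
            L.π₂ ∘ comparisonˡ         ≈⟨ L.π₂∘universal≈v left-commutes ⟩
            k                          ≈⟨ π₂m≈k ⟨
            π₂ ∘ m                     ∎)

    CollectionCondition-pasteʳ : g ∘ β ≈ α ∘ k → Cover 𝒞 α → CollectionCondition σ g f ρ →
                                 CollectionCondition (σ ∘ β) k f (ρ ∘ α)
    CollectionCondition-pasteʳ left-commutes α-cover collect t π₁ π₂ pb {E'} ε ε-cover =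
      refine (collect t π₁ π₂ pb ε ε-cover)
      where
      refine : CollectionWitness σ g ρ t π₁ π₂ ε → CollectionWitness (σ ∘ β) k (ρ ∘ α) t π₁ π₂ ε
      refine (T' , r , c , r-cover , ρc≈tr , lift) =
        S.P , r ∘ S.π₂ , S.π₁ , Cover-∘ (cover-stable α c S.π₁ S.π₂ S.isPullback α-cover) r-cover ,
        ≈.sym (glue-squares (≈.sym ρc≈tr) (≈.sym S.commute)) , restricted-lift
        where
        module S = PullbackOf α c
        module Dc = PullbackOf c g

        restricted-lift : ∀ {Q} (ρ₁ : Q ⇒ S.P) (ρ₂ : Q ⇒ F) → IsPullback 𝒞 S.π₁ k ρ₁ ρ₂ →
                          Σ (Q ⇒ E') λ h → (π₁ ∘ (ε ∘ h) ≈ (r ∘ S.π₂) ∘ ρ₁) ×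
                                           (π₂ ∘ (ε ∘ h) ≈ (σ ∘ β) ∘ ρ₂)
        restricted-lift {Q} ρ₁ ρ₂ pb′ with lift Dc.π₁ Dc.π₂ Dc.isPullback
        ... | h , π₁εh≈rπ₁ , π₂εh≈σπ₂ =
          h ∘ u ,
          ≈.trans (∘-resp-≈ʳ sym-assoc) (glue-squares π₁εh≈rπ₁ (Dc.π₁∘universal≈u u-commutes)) ,
          ≈.trans (∘-resp-≈ʳ sym-assoc) (glue-squares π₂εh≈σπ₂ (Dc.π₂∘universal≈v u-commutes))
          where
          u-commutes : c ∘ (S.π₂ ∘ ρ₁) ≈ g ∘ (β ∘ ρ₂)
          u-commutes = begin
            c ∘ (S.π₂ ∘ ρ₁)   ≈⟨ sym-assoc ⟩
            (c ∘ S.π₂) ∘ ρ₁   ≈⟨ pullˡ S.commute ⟨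
            α ∘ (S.π₁ ∘ ρ₁)   ≈⟨ ∘-resp-≈ʳ (Pullback.commute pb′) ⟩
            α ∘ (k ∘ ρ₂)      ≈⟨ sym-assoc ⟩
            (α ∘ k) ∘ ρ₂      ≈⟨ pullˡ left-commutes ⟨
            g ∘ (β ∘ ρ₂)      ∎

          u : Q ⇒ Dc.P
          u = Dc.universal u-commutes

    CollectionCondition-pasteˡ : f ∘ σ ≈ ρ ∘ g → Cover 𝒞 ρ → CollectionCondition β k g α →
                                 CollectionCondition (σ ∘ β) k f (ρ ∘ α)
    CollectionCondition-pasteˡ right-commutes ρ-cover collect {P = P} t π₁ π₂ pb ε ε-cover =
      widen (collect Cₜ.π₁ Dₜ.π₁ Dₜ.π₂ Dₜ.isPullback Eₜ.π₂
                     (cover-stable ε fibre-map Eₜ.π₁ Eₜ.π₂ Eₜ.isPullback ε-cover))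
      where
      module Pb = Pullback pb
      module Cₜ = PullbackOf ρ t
      module Dₜ = PullbackOf Cₜ.π₁ g

      fibre-map-commutes : t ∘ (Cₜ.π₂ ∘ Dₜ.π₁) ≈ f ∘ (σ ∘ Dₜ.π₂)
      fibre-map-commutes = begin
        t ∘ (Cₜ.π₂ ∘ Dₜ.π₁)   ≈⟨ glue-squares (≈.sym Cₜ.commute) Dₜ.commute ⟩
        (ρ ∘ g) ∘ Dₜ.π₂       ≈⟨ pullˡ right-commutes ⟨
        f ∘ (σ ∘ Dₜ.π₂)       ∎

      fibre-map : Dₜ.P ⇒ P
      fibre-map = Pb.universal fibre-map-commutes

      module Eₜ = PullbackOf ε fibre-map

      π₁-over-fibre-map : π₁ ∘ (ε ∘ Eₜ.π₁) ≈ Cₜ.π₂ ∘ (Dₜ.π₁ ∘ Eₜ.π₂)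
      π₁-over-fibre-map = begin
        π₁ ∘ (ε ∘ Eₜ.π₁)          ≈⟨ ∘-resp-≈ʳ Eₜ.commute ⟩
        π₁ ∘ (fibre-map ∘ Eₜ.π₂)  ≈⟨ pullˡ (Pb.π₁∘universal≈u fibre-map-commutes) ⟩
        (Cₜ.π₂ ∘ Dₜ.π₁) ∘ Eₜ.π₂   ≈⟨ assoc ⟩
        Cₜ.π₂ ∘ (Dₜ.π₁ ∘ Eₜ.π₂)   ∎

      π₂-over-fibre-map : π₂ ∘ (ε ∘ Eₜ.π₁) ≈ σ ∘ (Dₜ.π₂ ∘ Eₜ.π₂)
      π₂-over-fibre-map = begin
        π₂ ∘ (ε ∘ Eₜ.π₁)          ≈⟨ ∘-resp-≈ʳ Eₜ.commute ⟩
        π₂ ∘ (fibre-map ∘ Eₜ.π₂)  ≈⟨ pullˡ (Pb.π₂∘universal≈v fibre-map-commutes) ⟩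
        (σ ∘ Dₜ.π₂) ∘ Eₜ.π₂       ≈⟨ assoc ⟩
        σ ∘ (Dₜ.π₂ ∘ Eₜ.π₂)       ∎

      widen : CollectionWitness β k α Cₜ.π₁ Dₜ.π₁ Dₜ.π₂ Eₜ.π₂ →
              CollectionWitness (σ ∘ β) k (ρ ∘ α) t π₁ π₂ ε
      widen (T' , r , c , r-cover , αc≈r , lift) =
        T' , Cₜ.π₂ ∘ r , c ,
        Cover-∘ r-cover (cover-stable ρ t Cₜ.π₁ Cₜ.π₂ Cₜ.isPullback ρ-cover) ,
        ≈.sym (glue-squares (≈.sym Cₜ.commute) (≈.sym αc≈r)) ,
        λ ρ₁ ρ₂ pb′ → let h , h₁ , h₂ = lift ρ₁ ρ₂ pb′ in
          Eₜ.π₁ ∘ h ,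
          ≈.trans (∘-resp-≈ʳ sym-assoc) (glue-squares π₁-over-fibre-map (≈.trans assoc h₁)) ,
          ≈.trans (∘-resp-≈ʳ sym-assoc) (glue-squares π₂-over-fibre-map (≈.trans assoc h₂))

lemma3p4 : ∀ {o ℓ e : Level} (𝒞 : Category o ℓ e) → IsPositiveHeyting 𝒞 →
    let open Category 𝒞 in
    ∀ {A B C D E F : Obj}
      (β : F ⇒ D) (σ : D ⇒ B) (k : F ⇒ E) (g : D ⇒ C) (f : B ⇒ A) (α : E ⇒ C) (ρ : C ⇒ A) →
      CoveringSquare 𝒞 β k g α →
      CoveringSquare 𝒞 σ g f ρ →
      (CollectionSquare 𝒞 β k g α ⊎ CollectionSquare 𝒞 σ g f ρ) →
      CollectionSquare 𝒞 (σ ∘ β) k f (ρ ∘ α)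
lemma3p4 𝒞 positive-heyting β σ k g f α ρ
         left@(left-commutes , α-cover , _) right@(right-commutes , ρ-cover , _) collection =
  CoveringSquare-paste left right , outer-collection collection
  where
  open Category 𝒞
  open RegularCategory 𝒞 (IsHeyting.regular (IsPositiveHeyting.heyting positive-heyting))

  outer-collection : CollectionSquare 𝒞 β k g α ⊎ CollectionSquare 𝒞 σ g f ρ →
                     CollectionCondition (σ ∘ β) k f (ρ ∘ α)
  outer-collection (inj₁ (_ , collect)) = CollectionCondition-pasteˡ right-commutes ρ-cover collect
  outer-collection (inj₂ (_ , collect)) = CollectionCondition-pasteʳ left-commutes α-cover collect
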